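{- Let $w=w_1\cdots w_n$ be a word of distinct positive integers avoiding $31245,32145,31254,32154$. Let the left-to-right maxima of $w$ be at positions $l_1<\dots<l_s$ and the right-to-left maxima at positions $r_1<\dots<r_t$, so $1=l_1$, $l_s=r_1$, $r_t=n$. Suppose $t>1$, $l_s>s$, $s>2$ and $w_{l_{s-1}}>w_{r_2}$. Let $x=\max(\{j: j<l_{s-1},\ w_j>w_{j+1}\}\cup\{0\})$. Then one of the following holds: (II-1) $x=0$; (II-2) $x\neq0$ and $l_s=l_{s-1}+1$; (II-3) $x\neq 0$, $l_s>l_{s-1}+1$, and with $k=\max\{i: l_{s-1}<i<l_s,\ w_x<w_i<w_{l_{s-1}}\}$ (this set being nonempty) we have $w_{l_{s-1}}>w_j>w_x$ for $l_{s-1}<j\le k$ and $w_j<w_x$ for $k<j<l_s$; moreover, if $k<l_s-1$ then $w_x>w_{r_2}$; (II-4) $x\neq0$, $l_s>l_{s-1}+1$ and $w_j<w_x$ for all $l_{s-1}<j<l_s$; moreover in this case $w_x>w_{r_2}$.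
   Context: A word avoids a pattern $P$ if it has no subsequence order-isomorphic to $P$. A left-to-right (resp. right-to-left) maximum of $w$ is an entry larger than all entries to its left (resp. right). -}

module Defs where

open import Data.Nat using (ℕ; zero; suc; _≤_; _<_)
open import Data.Fin using (Fin) renaming (_<_ to _<ᶠ_)
open import Relation.Nullary using (¬_)
open import Data.Vec using (Vec; _∷_; []; lookup)
open import Data.Product using (Σ; _×_; ∃)
open import Data.Sum using (_⊎_)
open import Function.Bundles using (_⇔_)
open import Relation.Binary.PropositionalEquality using (_≡_)

-- A word of length n is w : ℕ → ℕ, read at positions 1,…,n (1-indexed);
-- values outside [1,n] are irrelevant.
Word : Set
Word = ℕ → ℕ

DistinctPositive : ℕ → Word → Set
DistinctPositive n w =
  (∀ i → 1 ≤ i → i ≤ n → 1 ≤ w i) ×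
  (∀ i j → 1 ≤ i → i ≤ n → 1 ≤ j → j ≤ n → w i ≡ w j → i ≡ j)

Contains : ℕ → Word → (k : ℕ) → (Fin k → ℕ) → Set
Contains n w k P =
  Σ (Fin k → ℕ) λ f →
    (∀ a → 1 ≤ f a × f a ≤ n) ×
    (∀ a b → a <ᶠ b → f a < f b) ×
    (∀ a b → (P a < P b) ⇔ (w (f a) < w (f b)))

Avoids : ℕ → Word → (k : ℕ) → (Fin k → ℕ) → Set
Avoids n w k P = ¬ Contains n w k P

pat : Vec ℕ 5 → Fin 5 → ℕ
pat v = lookup v

p31245 p32145 p31254 p32154 : Fin 5 → ℕ
p31245 = pat (3 ∷ 1 ∷ 2 ∷ 4 ∷ 5 ∷ [])
p32145 = pat (3 ∷ 2 ∷ 1 ∷ 4 ∷ 5 ∷ [])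
p31254 = pat (3 ∷ 1 ∷ 2 ∷ 5 ∷ 4 ∷ [])
p32154 = pat (3 ∷ 2 ∷ 1 ∷ 5 ∷ 4 ∷ [])

IsLTRMax : ℕ → Word → ℕ → Set
IsLTRMax n w p = 1 ≤ p × p ≤ n × (∀ j → 1 ≤ j → j < p → w j < w p)

IsRTLMax : ℕ → Word → ℕ → Set
IsRTLMax n w p = 1 ≤ p × p ≤ n × (∀ j → p < j → j ≤ n → w j < w p)

Enumerates : (ℕ → Set) → ℕ → (ℕ → ℕ) → Set
Enumerates Q s l =
  (∀ i → 1 ≤ i → i < s → l i < l (suc i)) ×
  (∀ i → 1 ≤ i → i ≤ s → Q (l i)) ×
  (∀ p → Q p → ∃ λ i → 1 ≤ i × i ≤ s × l i ≡ p)

IsMax : (ℕ → Set) → ℕ → Set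
IsMax P x = P x × (∀ y → P y → y ≤ x)

{-# OPTIONS --safe #-}
-- The four patterns 31245, 32145, 31254, 32154 are precisely the five-entry
-- subsequences whose first entry lies above the next two and below the last
-- two.  Hence, after a descent w_x > w_{x+1}, an entry below w_x followed by
-- an entry above w_x forces every entry further right to be below w_x.  The
-- last left-to-right maximum w_{l_s} is the global maximum, so it exceeds w_x,
-- and r_2 lies to the right of l_s; every entry strictly between l_{s-1} and
-- l_s is below w_{l_{s-1}}.  Choosing k as the last entry of that gap with a
-- value between w_x and w_{l_{s-1}}, these facts give (II-3) and (II-4).
module Submission where

open import Defs
open import Data.Nat using (ℕ; zero; suc; _≤_; _<_; _∸_; _+_)
open import Data.Product using (Σ; _×_; ∃)
open import Data.Sum using (_⊎_)
open import Relation.Binary.PropositionalEquality using (_≡_; _≢_)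

open import Data.Nat using (z≤n; s≤s; pred; _<?_; _≤?_)
open import Data.Nat.Properties
open import Data.Fin using (toℕ)
open import Data.Fin.Properties using (toℕ≤pred[n])
open import Data.Vec using (Vec; _∷_; []; lookup; tabulate; map)
open import Data.Vec.Properties using (lookup∘tabulate; lookup-map)
open import Data.Vec.Relation.Unary.All using (All; all?)
open import Data.Vec.Relation.Unary.All.Properties using (lookup⁺)
open import Data.Product using (_,_; proj₁; proj₂)
open import Data.Sum using (inj₁; inj₂)
open import Data.Empty using (⊥; ⊥-elim)
open import Function.Base using (_∘_; case_of_)
open import Function.Bundles using (_⇔_; mk⇔)
open import Relation.Nullary using (¬_; yes; no)
open import Relation.Nullary.Decidable using (True; toWitness; _×-dec_)
open import Relation.Unary using (Decidable)
open import Relation.Binary using (tri<; tri≈; tri>)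
open import Relation.Binary.PropositionalEquality
  using (refl; sym; trans; cong; subst; subst₂; ≢-sym)

module _ (g : ℕ → ℕ) {lo hi : ℕ} (step : ∀ i → lo ≤ i → i < hi → g i < g (suc i)) where

  stepwise-< : ∀ {i j} → lo ≤ i → i < j → j ≤ hi → g i < g j
  stepwise-< {i} {suc j} lo≤i (s≤s i≤j) j<hi with m≤n⇒m<n∨m≡n i≤j
  ... | inj₂ refl = step i lo≤i j<hi
  ... | inj₁ i<j  = <-trans (stepwise-< lo≤i i<j (<⇒≤ j<hi))
                            (step j (≤-trans lo≤i (<⇒≤ i<j)) j<hi)

  stepwise-≤ : ∀ {i j} → lo ≤ i → i ≤ j → j ≤ hi → g i ≤ g j
  stepwise-≤ lo≤i i≤j j≤hi with m≤n⇒m<n∨m≡n i≤j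
  ... | inj₁ i<j  = <⇒≤ (stepwise-< lo≤i i<j j≤hi)
  ... | inj₂ refl = ≤-refl

<∸1⇒suc< : ∀ {m n} → m < n ∸ 1 → suc m < n
<∸1⇒suc< {n = suc n} m<n = s≤s m<n

greatest? : (D : ℕ → Set) → Decidable D → ∀ b → (∀ i → D i → i < b) →
            (∀ i → ¬ D i) ⊎ ∃ (IsMax D)
greatest? D D? zero    bounded = inj₁ λ i Di → n≮0 (bounded i Di)
greatest? D D? (suc b) bounded with D? b
... | yes Db = inj₂ (b , Db , λ i Di → ≤-pred (bounded i Di))
... | no ¬Db = greatest? D D? b λ i Di → ≤∧≢⇒< (≤-pred (bounded i Di)) λ { refl → ¬Db Di }

-- val u is the entry of w realising rank u of the pattern.
contains-by-ranks : ∀ {n w k} (v : Vec ℕ k) (pos val : ℕ → ℕ) →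
  1 ≤ pos 0 → pos (pred k) ≤ n → (∀ i → i < pred k → pos i < pos (suc i)) →
  (∀ u → 1 ≤ u → u < k → val u < val (suc u)) → All (λ u → 1 ≤ u × u ≤ k) v →
  tabulate (λ a → w (pos (toℕ a))) ≡ map val v → Contains n w k (lookup v)
contains-by-ranks {n} {w} {k} v pos val 1≤pos₀ pos≤n pos-step val-step ranks w≡val =
  pos ∘ toℕ , bounds , increasing , order-iso
  where
  pos-step′ : ∀ i → 0 ≤ i → i < pred k → pos i < pos (suc i)
  pos-step′ i _ = pos-step i

  bounds : ∀ a → 1 ≤ pos (toℕ a) × pos (toℕ a) ≤ n
  bounds a = ≤-trans 1≤pos₀ (stepwise-≤ pos pos-step′ z≤n z≤n (toℕ≤pred[n] a))
           , ≤-trans (stepwise-≤ pos pos-step′ z≤n (toℕ≤pred[n] a) ≤-refl) pos≤n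

  increasing : ∀ a b → toℕ a < toℕ b → pos (toℕ a) < pos (toℕ b)
  increasing a b a<b = stepwise-< pos pos-step′ z≤n a<b (toℕ≤pred[n] b)

  w≡val∘v : ∀ a → w (pos (toℕ a)) ≡ val (lookup v a)
  w≡val∘v a = trans (sym (lookup∘tabulate _ a))
                    (trans (cong (λ u → lookup u a) w≡val) (lookup-map a val v))

  order-iso : ∀ a b → (lookup v a < lookup v b) ⇔ (w (pos (toℕ a)) < w (pos (toℕ b)))
  order-iso a b = mk⇔ to from
    where
    ra : 1 ≤ lookup v a × lookup v a ≤ k
    ra = lookup⁺ ranks a
    rb : 1 ≤ lookup v b × lookup v b ≤ k
    rb = lookup⁺ ranks b
    to : lookup v a < lookup v b → w (pos (toℕ a)) < w (pos (toℕ b))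
    to va<vb = subst₂ _<_ (sym (w≡val∘v a)) (sym (w≡val∘v b))
                      (stepwise-< val val-step (proj₁ ra) va<vb (proj₂ rb))
    from : w (pos (toℕ a)) < w (pos (toℕ b)) → lookup v a < lookup v b
    from wa<wb with lookup v a <? lookup v b
    ... | yes va<vb = va<vb
    ... | no va≮vb  = ⊥-elim (<⇒≱ (subst₂ _<_ (w≡val∘v a) (w≡val∘v b) wa<wb)
                                  (stepwise-≤ val val-step (proj₁ rb) (≮⇒≥ va≮vb) (proj₂ ra)))

-- Indexed from 1 like pattern ranks; the value 0 elsewhere is junk.
seq₅ : (a₁ a₂ a₃ a₄ a₅ : ℕ) → ℕ → ℕ
seq₅ a₁ a₂ a₃ a₄ a₅ 1 = a₁
seq₅ a₁ a₂ a₃ a₄ a₅ 2 = a₂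
seq₅ a₁ a₂ a₃ a₄ a₅ 3 = a₃
seq₅ a₁ a₂ a₃ a₄ a₅ 4 = a₄
seq₅ a₁ a₂ a₃ a₄ a₅ 5 = a₅
seq₅ a₁ a₂ a₃ a₄ a₅ _ = 0

seq₅-step : ∀ {a₁ a₂ a₃ a₄ a₅} → a₁ < a₂ → a₂ < a₃ → a₃ < a₄ → a₄ < a₅ →
            ∀ u → 1 ≤ u → u < 5 → seq₅ a₁ a₂ a₃ a₄ a₅ u < seq₅ a₁ a₂ a₃ a₄ a₅ (suc u)
seq₅-step a₁<a₂ _ _ _ 1 _ _ = a₁<a₂
seq₅-step _ a₂<a₃ _ _ 2 _ _ = a₂<a₃
seq₅-step _ _ a₃<a₄ _ 3 _ _ = a₃<a₄
seq₅-step _ _ _ a₄<a₅ 4 _ _ = a₄<a₅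
seq₅-step _ _ _ _ (suc (suc (suc (suc (suc _))))) _ (s≤s (s≤s (s≤s (s≤s (s≤s ())))))

prefix-argmax : (w : Word) → ∀ m → 1 ≤ m →
                ∃ λ g → 1 ≤ g × g ≤ m × (∀ j → 1 ≤ j → j ≤ m → w j ≤ w g)
prefix-argmax w (suc zero) _ = 1 , ≤-refl , ≤-refl , λ j 1≤j j≤1 → ≤-reflexive (cong w (≤-antisym j≤1 1≤j))
prefix-argmax w (suc (suc m)) _ with prefix-argmax w (suc m) (s≤s z≤n)
... | g , 1≤g , g≤m , max with w g ≤? w (suc (suc m))
...   | yes wg≤ = suc (suc m) , s≤s z≤n , ≤-refl , max′
  where
  max′ : ∀ j → 1 ≤ j → j ≤ suc (suc m) → w j ≤ w (suc (suc m))
  max′ j 1≤j j≤ with m≤n⇒m<n∨m≡n j≤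
  ... | inj₁ j< = ≤-trans (max j 1≤j (≤-pred j<)) wg≤
  ... | inj₂ refl = ≤-refl
...   | no wg≰ = g , 1≤g , m≤n⇒m≤1+n g≤m , max′
  where
  max′ : ∀ j → 1 ≤ j → j ≤ suc (suc m) → w j ≤ w g
  max′ j 1≤j j≤ with m≤n⇒m<n∨m≡n j≤
  ... | inj₁ j< = max j 1≤j (≤-pred j<)
  ... | inj₂ refl = <⇒≤ (≰⇒> wg≰)

enumerates-≤ : ∀ {Q s l i j} → Enumerates Q s l → 1 ≤ i → i ≤ j → j ≤ s → l i ≤ l j
enumerates-≤ {l = l} (step , _) = stepwise-≤ l step

module _ {n : ℕ} {w : Word} (distinct : DistinctPositive n w) where

  values-≢ : ∀ {i j} → 1 ≤ i → i < j → j ≤ n → w i ≢ w j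
  values-≢ 1≤i i<j j≤n e = <⇒≢ i<j
    (proj₂ distinct _ _ 1≤i (≤-trans (<⇒≤ i<j) j≤n) (≤-trans 1≤i (<⇒≤ i<j)) j≤n e)

  values-cmp : ∀ {i j} → 1 ≤ i → i < j → j ≤ n → w i < w j ⊎ w j < w i
  values-cmp {i} {j} 1≤i i<j j≤n with <-cmp (w i) (w j)
  ... | tri< wi<wj _ _ = inj₁ wi<wj
  ... | tri≈ _ e _     = ⊥-elim (values-≢ 1≤i i<j j≤n e)
  ... | tri> _ _ wj<wi = inj₂ wj<wi

  ltrMax-≥ : ∀ {p q} → 1 ≤ p → p ≤ q → IsLTRMax n w q → w p ≤ w q
  ltrMax-≥ 1≤p p≤q (_ , _ , max) with m≤n⇒m<n∨m≡n p≤q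
  ... | inj₁ p<q  = <⇒≤ (max _ 1≤p p<q)
  ... | inj₂ refl = ≤-refl

  weak-ltrMax⇒ltrMax : ∀ {g} → 1 ≤ g → g ≤ n → (∀ j → 1 ≤ j → j < g → w j ≤ w g) → IsLTRMax n w g
  weak-ltrMax⇒ltrMax 1≤g g≤n max = 1≤g , g≤n , λ j 1≤j j<g → ≤∧≢⇒< (max j 1≤j j<g) (values-≢ 1≤j j<g g≤n)

  module _ {s : ℕ} {l : ℕ → ℕ} (ltr : Enumerates (IsLTRMax n w) s l) where

    ltrMax-dominates : ∀ i → 1 ≤ i → i ≤ n → ∃ λ j → 1 ≤ j × j ≤ s × l j ≤ i × w i ≤ w (l j)
    ltrMax-dominates i 1≤i i≤n with prefix-argmax w i 1≤i
    ... | g , 1≤g , g≤i , max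
      with proj₂ (proj₂ ltr) g (weak-ltrMax⇒ltrMax 1≤g (≤-trans g≤i i≤n) λ j 1≤j j<g → max j 1≤j (≤-trans (<⇒≤ j<g) g≤i))
    ...   | j , 1≤j , j≤s , refl = j , 1≤j , j≤s , g≤i , max i 1≤i ≤-refl

    l-isLTRMax : ∀ {j} → 1 ≤ j → j ≤ s → IsLTRMax n w (l j)
    l-isLTRMax = proj₁ (proj₂ ltr) _

    between-ltrMaxima : ∀ {j i} → 1 ≤ j → j < s → l j < i → i < l (suc j) → w i < w (l j)
    between-ltrMaxima {j} {i} 1≤j j<s lj<i i<lj+1 = ≤∧≢⇒< wi≤wlj (≢-sym (values-≢ 1≤lj lj<i i≤n))
      where
      1≤lj : 1 ≤ l j
      1≤lj = proj₁ (l-isLTRMax 1≤j (<⇒≤ j<s))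
      i≤n : i ≤ n
      i≤n = ≤-trans (<⇒≤ i<lj+1) (proj₁ (proj₂ (l-isLTRMax (s≤s z≤n) j<s)))

      wi≤wlj : w i ≤ w (l j)
      wi≤wlj with ltrMax-dominates i (≤-trans 1≤lj (<⇒≤ lj<i)) i≤n
      ... | j′ , 1≤j′ , j′≤s , lj′≤i , wi≤wlj′ =
        ≤-trans wi≤wlj′ (ltrMax-≥ (proj₁ (l-isLTRMax 1≤j′ j′≤s)) (enumerates-≤ ltr 1≤j′ j′≤j (<⇒≤ j<s))
                                  (l-isLTRMax 1≤j (<⇒≤ j<s)))
        where
        j′≤j : j′ ≤ j
        j′≤j with j′ ≤? j
        ... | yes j′≤j = j′≤j
        ... | no j′≰j  = ⊥-elim (<⇒≱ (≤-<-trans lj′≤i i<lj+1)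
                                     (enumerates-≤ ltr (s≤s z≤n) (≰⇒> j′≰j) j′≤s))

    last-ltrMax-is-max : 1 ≤ s → ∀ i → 1 ≤ i → i ≤ n → w i ≤ w (l s)
    last-ltrMax-is-max 1≤s i 1≤i i≤n with ltrMax-dominates i 1≤i i≤n
    ... | j , 1≤j , j≤s , _ , wi≤wlj =
      ≤-trans wi≤wlj (ltrMax-≥ (proj₁ (l-isLTRMax 1≤j j≤s)) (enumerates-≤ ltr 1≤j j≤s ≤-refl)
                               (l-isLTRMax 1≤s ≤-refl))

    last-ltrMax<second-rtlMax : ∀ {t r} → Enumerates (IsRTLMax n w) t r → 1 < t → 1 ≤ s → l s < r 2
    last-ltrMax<second-rtlMax {r = r} (r-step , rtl , _) 1<t 1≤s with l s <? r 2
    ... | yes ls<r₂ = ls<r₂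
    ... | no ls≮r₂  = ⊥-elim (<⇒≱ (r₁-max (l s) (<-≤-trans (r-step 1 ≤-refl 1<t) (≮⇒≥ ls≮r₂)) ls≤n)
                                  (last-ltrMax-is-max 1≤s (r 1) (proj₁ r₁-rtl) (proj₁ (proj₂ r₁-rtl))))
      where
      r₁-rtl : IsRTLMax n w (r 1)
      r₁-rtl = rtl 1 ≤-refl (<⇒≤ 1<t)
      r₁-max : ∀ j → r 1 < j → j ≤ n → w j < w (r 1)
      r₁-max = proj₂ (proj₂ r₁-rtl)
      ls≤n : l s ≤ n
      ls≤n = proj₁ (proj₂ (l-isLTRMax 1≤s ≤-refl))

  module _ (avoids-31245 : Avoids n w 5 p31245) (avoids-32145 : Avoids n w 5 p32145)
           (avoids-31254 : Avoids n w 5 p31254) (avoids-32154 : Avoids n w 5 p32154) where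

    no-3-12-45 : ∀ {p₀ p₁ p₂ p₃ p₄} → 1 ≤ p₀ → p₀ < p₁ → p₁ < p₂ → p₂ < p₃ → p₃ < p₄ → p₄ ≤ n →
                 w p₁ < w p₀ → w p₂ < w p₀ → w p₀ < w p₃ → w p₀ < w p₄ → ⊥
    no-3-12-45 {p₀} {p₁} {p₂} {p₃} {p₄} 1≤p₀ p₀<p₁ p₁<p₂ p₂<p₃ p₃<p₄ p₄≤n w₁<w₀ w₂<w₀ w₀<w₃ w₀<w₄ =
      split (values-cmp 1≤p₁ p₁<p₂ (<⇒≤ (<-≤-trans p₂<p₃ p₃≤n))) (values-cmp 1≤p₃ p₃<p₄ p₄≤n)
      where
      1≤p₁ : 1 ≤ p₁
      1≤p₁ = ≤-trans 1≤p₀ (<⇒≤ p₀<p₁)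
      1≤p₃ : 1 ≤ p₃
      1≤p₃ = ≤-trans 1≤p₁ (<⇒≤ (<-trans p₁<p₂ p₂<p₃))
      p₃≤n : p₃ ≤ n
      p₃≤n = ≤-trans (<⇒≤ p₃<p₄) p₄≤n

      pos : ℕ → ℕ
      pos i = seq₅ p₀ p₁ p₂ p₃ p₄ (suc i)

      embeds : ∀ {v₁ v₂ v₃ v₄ v₅} (v : Vec ℕ 5)
               {_ : True (all? (λ u → (1 ≤? u) ×-dec (u ≤? 5)) v)} →
               v₁ < v₂ → v₂ < v₃ → v₃ < v₄ → v₄ < v₅ →
               tabulate (λ a → w (pos (toℕ a))) ≡ map (seq₅ v₁ v₂ v₃ v₄ v₅) v →
               Contains n w 5 (lookup v)
      embeds v {in-range} v₁<v₂ v₂<v₃ v₃<v₄ v₄<v₅ =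
        contains-by-ranks v pos _ 1≤p₀ p₄≤n
          (λ i i<4 → seq₅-step p₀<p₁ p₁<p₂ p₂<p₃ p₃<p₄ (suc i) (s≤s z≤n) (s≤s i<4))
          (seq₅-step v₁<v₂ v₂<v₃ v₃<v₄ v₄<v₅) (toWitness in-range)

      split : w p₁ < w p₂ ⊎ w p₂ < w p₁ → w p₃ < w p₄ ⊎ w p₄ < w p₃ → ⊥
      split (inj₁ w₁<w₂) (inj₁ w₃<w₄) = avoids-31245 (embeds (3 ∷ 1 ∷ 2 ∷ 4 ∷ 5 ∷ []) w₁<w₂ w₂<w₀ w₀<w₃ w₃<w₄ refl)
      split (inj₂ w₂<w₁) (inj₁ w₃<w₄) = avoids-32145 (embeds (3 ∷ 2 ∷ 1 ∷ 4 ∷ 5 ∷ []) w₂<w₁ w₁<w₀ w₀<w₃ w₃<w₄ refl)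
      split (inj₁ w₁<w₂) (inj₂ w₄<w₃) = avoids-31254 (embeds (3 ∷ 1 ∷ 2 ∷ 5 ∷ 4 ∷ []) w₁<w₂ w₂<w₀ w₀<w₄ w₄<w₃ refl)
      split (inj₂ w₂<w₁) (inj₂ w₄<w₃) = avoids-32154 (embeds (3 ∷ 2 ∷ 1 ∷ 5 ∷ 4 ∷ []) w₂<w₁ w₁<w₀ w₀<w₄ w₄<w₃ refl)

    descent-low-high⇒low : ∀ {x j k m} → 1 ≤ x → w (suc x) < w x →
      suc x < j → j < k → k < m → m ≤ n → w j < w x → w x < w k → w m < w x
    descent-low-high⇒low 1≤x descent x+1<j j<k k<m m≤n wj<wx wx<wk
      with values-cmp 1≤x (<-trans (<-trans (<-trans ≤-refl x+1<j) j<k) k<m) m≤n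
    ... | inj₂ wm<wx = wm<wx
    ... | inj₁ wx<wm = ⊥-elim (no-3-12-45 1≤x ≤-refl x+1<j j<k k<m m≤n descent wj<wx wx<wk wx<wm)

    module Gap {x L M r₂ : ℕ} (1≤x : 1 ≤ x) (descent : w (suc x) < w x)
               (x<L : x < L) (L<M : L < M) (M<r₂ : M < r₂) (r₂≤n : r₂ ≤ n)
               (wx<wM : w x < w M) (below-L : ∀ {i} → L < i → i < M → w i < w L) where

      Mid : ℕ → Set
      Mid i = L < i × i < M × w x < w i × w i < w L

      Mid? : Decidable Mid
      Mid? i = (L <? i) ×-dec (i <? M) ×-dec (w x <? w i) ×-dec (w i <? w L)

      M≤n : M ≤ n
      M≤n = ≤-trans (<⇒≤ M<r₂) r₂≤n

      low-outside-Mid : ∀ {j} → L < j → j < M → ¬ Mid j → w j < w x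
      low-outside-Mid L<j j<M ¬mid with values-cmp 1≤x (<-trans x<L L<j) (≤-trans (<⇒≤ j<M) M≤n)
      ... | inj₁ wx<wj = ⊥-elim (¬mid (L<j , j<M , wx<wj , below-L L<j j<M))
      ... | inj₂ wj<wx = wj<wx

      no-Mid⇒low : (∀ i → ¬ Mid i) → ∀ j → L < j → j < M → w j < w x
      no-Mid⇒low no-mid j L<j j<M = low-outside-Mid L<j j<M (no-mid j)

      r₂-low : ∀ {j} → L < j → j < M → w j < w x → w r₂ < w x
      r₂-low L<j j<M wj<wx =
        descent-low-high⇒low 1≤x descent (≤-<-trans x<L L<j) j<M M<r₂ r₂≤n wj<wx wx<wM

      module _ {k : ℕ} (k-greatest : IsMax Mid k) where
        private
          L<k : L < k
          L<k = proj₁ (proj₁ k-greatest)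
          k<M : k < M
          k<M = proj₁ (proj₂ (proj₁ k-greatest))
          wx<wk : w x < w k
          wx<wk = proj₁ (proj₂ (proj₂ (proj₁ k-greatest)))

        high-up-to-max : ∀ j → L < j → j ≤ k → w x < w j × w j < w L
        high-up-to-max j L<j j≤k with m≤n⇒m<n∨m≡n j≤k
        ... | inj₂ refl = proj₂ (proj₂ (proj₁ k-greatest))
        ... | inj₁ j<k with values-cmp 1≤x (<-trans x<L L<j) (≤-trans (<⇒≤ (<-trans j<k k<M)) M≤n)
        ...   | inj₁ wx<wj = wx<wj , below-L L<j (<-trans j<k k<M)
        ...   | inj₂ wj<wx = ⊥-elim (<-asym wx<wM
                (descent-low-high⇒low 1≤x descent (≤-<-trans x<L L<j) j<k k<M M≤n wj<wx wx<wk))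

        low-after-max : ∀ j → k < j → j < M → w j < w x
        low-after-max j k<j j<M =
          low-outside-Mid (<-trans L<k k<j) j<M λ mid-j → <⇒≱ k<j (proj₂ k-greatest j mid-j)

        r₂-low-if-gap-after-max : k < M ∸ 1 → w r₂ < w x
        r₂-low-if-gap-after-max k<M-1 =
          r₂-low (<-trans L<k ≤-refl) k+1<M (low-after-max (suc k) ≤-refl k+1<M)
          where
          k+1<M : suc k < M
          k+1<M = <∸1⇒suc< k<M-1

lemma3p2 : (n : ℕ) (w : Word) →
    DistinctPositive n w →
    Avoids n w 5 p31245 → Avoids n w 5 p32145 →
    Avoids n w 5 p31254 → Avoids n w 5 p32154 →
    (s : ℕ) (l : ℕ → ℕ) → Enumerates (IsLTRMax n w) s l →
    (t : ℕ) (r : ℕ → ℕ) → Enumerates (IsRTLMax n w) t r →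
    1 < t → s < l s → 2 < s → w (r 2) < w (l (s ∸ 1)) →
    (x : ℕ) →
    IsMax (λ j → j ≡ 0 ⊎ (1 ≤ j × j < l (s ∸ 1) × w (suc j) < w j)) x →
    -- (II-1)
    (x ≡ 0)
    -- (II-2)
    ⊎ (x ≢ 0 × l s ≡ l (s ∸ 1) + 1)
    -- (II-3)
    ⊎ (x ≢ 0 × l (s ∸ 1) + 1 < l s ×
        ∃ λ k →
          IsMax (λ i → l (s ∸ 1) < i × i < l s × w x < w i × w i < w (l (s ∸ 1))) k ×
          (∀ j → l (s ∸ 1) < j → j ≤ k → w x < w j × w j < w (l (s ∸ 1))) ×
          (∀ j → k < j → j < l s → w j < w x) ×
          (k < l s ∸ 1 → w (r 2) < w x))
    -- (II-4)
    ⊎ (x ≢ 0 × l (s ∸ 1) + 1 < l s ×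
        (∀ j → l (s ∸ 1) < j → j < l s → w j < w x) ×
        w (r 2) < w x)
lemma3p2 n w dp A₁ A₂ A₃ A₄ zero l ltr t r rtl 1<t _ () _ x _
lemma3p2 n w dp A₁ A₂ A₃ A₄ (suc s) l ltr t r rtl 1<t _ (s≤s 1<s) _ x (inj₁ x≡0 , _) = inj₁ x≡0
lemma3p2 n w dp A₁ A₂ A₃ A₄ (suc s) l ltr t r rtl 1<t _ (s≤s 1<s) _ x (inj₂ (1≤x , x<L , descent) , _) =
  case m≤n⇒m<n∨m≡n L<M of λ where
    (inj₂ L+1≡M) → inj₂ (inj₁ (x≢0 , trans (sym L+1≡M) (+-comm 1 (l s))))
    (inj₁ L+1<M) → case greatest? Mid Mid? (l (suc s)) (λ _ → proj₁ ∘ proj₂) of λ where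
      (inj₁ no-mid) → inj₂ (inj₂ (inj₂ (x≢0 , L+1<M′ L+1<M , no-Mid⇒low no-mid ,
        r₂-low ≤-refl L+1<M (no-Mid⇒low no-mid _ ≤-refl L+1<M))))
      (inj₂ (k , k-greatest)) → inj₂ (inj₂ (inj₁ (x≢0 , L+1<M′ L+1<M , k , k-greatest ,
        high-up-to-max k-greatest , low-after-max k-greatest , r₂-low-if-gap-after-max k-greatest)))
  where
  1≤s : 1 ≤ s
  1≤s = <⇒≤ 1<s
  L<M : l s < l (suc s)
  L<M = proj₁ ltr s 1≤s ≤-refl
  x≢0 : x ≢ 0
  x≢0 = m<n⇒n≢0 1≤x
  L+1<M′ : suc (l s) < l (suc s) → l s + 1 < l (suc s)
  L+1<M′ = subst (_< l (suc s)) (+-comm 1 (l s))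
  r₂≤n : r 2 ≤ n
  r₂≤n = proj₁ (proj₂ (proj₁ (proj₂ rtl) 2 (s≤s z≤n) 1<t))
  wx<wM : w x < w (l (suc s))
  wx<wM = proj₂ (proj₂ (l-isLTRMax dp ltr (s≤s z≤n) ≤-refl)) x 1≤x (<-trans x<L L<M)
  open Gap dp A₁ A₂ A₃ A₄ 1≤x descent x<L L<M (last-ltrMax<second-rtlMax dp ltr rtl 1<t (s≤s z≤n))
           r₂≤n wx<wM (between-ltrMaxima dp ltr 1≤s ≤-refl)
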